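{- Let \(G\) be a graph having the \(m\times n\) queen's graph \(Q_{m,n}\) as a spanning subgraph. Let \(D\) be a row-equitable effective divisor on \(G\) with \(r(D)>0\) and \(\deg(D)\leq mn-1\), and let \(q\) be a vertex with \(D(q)=0\). Suppose that when running Dhar's burning algorithm on \(D\) starting from \(q\), a poorest row (of \(D\)) burns entirely. Then \(\deg(D)\geq (m-1)n+2\).
   Context: For \(m,n\geq 2\), \(Q_{m,n}\) is the simple graph on \(\{(x,y):0\leq x\leq m-1,\ 0\leq y\leq n-1\}\) with \((x,y)\neq(x',y')\) adjacent iff \(x=x'\), \(y=y'\), or \(|x-x'|=|y-y'|\). "\(G\) has \(Q_{m,n}\) as a spanning subgraph" means \(V(G)\) is this vertex set and every edge of \(Q_{m,n}\) is an edge of \(G\). A row is a set \(\{(x,y):0\leq x\leq m-1\}\) for fixed \(y\) (it has \(m\) vertices). Chip-firing: a divisor is an element of \(\mathbb{Z}^{V(G)}\); degree = sum of entries; effective = all entries nonnegative. Firing a vertex \(v\) sends one chip along each incident edge to the neighbor. Divisors are equivalent if related by a sequence of firings. Rank: \(r(D)=-1\) if \(D\) is not equivalent to an effective divisor; otherwise \(r(D)\) is the largest \(k\geq0\) such that \(D-E\) is equivalent to an effective divisor for every effective \(E\) of degree \(k\). For an effective divisor, a poorest row is a row containing the smallest number of chips among all rows. An effective divisor \(D\) is row-equitable if, among all effective divisors equivalent to \(D\), \(D\) maximizes the number of chips on its poorest row. Dhar's burning algorithm from \(q\) (for \(D\) with \(D(v)\geq0\) for \(v\neq q\)): \(q\)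 burns; repeatedly, every edge incident to a burning vertex burns, and any vertex \(v\neq q\) with more than \(D(v)\) burning incident edges burns; until stable. -}

module Defs where

open import Data.Bool using (Bool; true; false; _∧_; _∨_; not; if_then_else_)
open import Data.Nat as ℕ using (ℕ; zero; suc)
open import Data.Fin using (Fin; toℕ) renaming (zero to fz; suc to fs)
import Data.Fin as Fin
open import Data.Integer using (ℤ; +_; _+_; _-_; _*_; _≤_; _<_; _<?_)
open import Data.Product using (Σ; _×_; _,_; proj₁; proj₂; ∃)
open import Relation.Nullary using (¬_; does)
open import Relation.Nullary.Decidable using (⌊_⌋)
open import Relation.Binary.PropositionalEquality using (_≡_)
open import Relation.Binary.Construct.Closure.Equivalence using (EqClosure)

-- Vertices of Q_{m,n}: (x , y) with x : Fin m (column), y : Fin n (row index).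
Vtx : ℕ → ℕ → Set
Vtx m n = Fin m × Fin n

dist : ℕ → ℕ → ℕ
dist a b = (a ℕ.∸ b) ℕ.+ (b ℕ.∸ a)

QueenAdj : ∀ {m n} → Vtx m n → Vtx m n → Set
QueenAdj (x , y) (x' , y') =
  (x ≡ x') Data.Sum.⊎ ((y ≡ y') Data.Sum.⊎ (dist (toℕ x) (toℕ x') ≡ dist (toℕ y) (toℕ y')))
  where import Data.Sum

record SimpleGraph (m n : ℕ) : Set where
  field
    adj       : Vtx m n → Vtx m n → Bool
    adj-sym   : ∀ u v → adj u v ≡ adj v u
    adj-irrefl : ∀ v → adj v v ≡ false
open SimpleGraph public

HasQueenSpanning : ∀ {m n} → SimpleGraph m n → Set
HasQueenSpanning {m} {n} G =
  ∀ (u v : Vtx m n) → ¬ (u ≡ v) → QueenAdj u v → adj G u v ≡ true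

sumFin : ∀ k → (Fin k → ℤ) → ℤ
sumFin zero    f = + 0
sumFin (suc k) f = f fz + sumFin k (λ i → f (fs i))

sumV : ∀ {m n} → (Vtx m n → ℤ) → ℤ
sumV {m} {n} f = sumFin m (λ x → sumFin n (λ y → f (x , y)))

b2z : Bool → ℤ
b2z true  = + 1
b2z false = + 0

Divisor : ℕ → ℕ → Set
Divisor m n = Vtx m n → ℤ

deg : ∀ {m n} → Divisor m n → ℤ
deg D = sumV D

Effective : ∀ {m n} → Divisor m n → Set
Effective D = ∀ v → + 0 ≤ D v

_-ᴰ_ : ∀ {m n} → Divisor m n → Divisor m n → Divisor m n
(D -ᴰ E) v = D v - E v

valence : ∀ {m n} → SimpleGraph m n → Vtx m n → ℤ
valence G v = sumV (λ w → b2z (adj G v w))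

_≟V_ : ∀ {m n} → (u v : Vtx m n) → Relation.Nullary.Dec (u ≡ v)
_≟V_ = Data.Product.Properties.≡-dec Fin._≟_ Fin._≟_
  where import Data.Product.Properties

fire : ∀ {m n} → SimpleGraph m n → Vtx m n → Divisor m n → Divisor m n
fire G v D w with does (w ≟V v)
... | true  = D w - valence G v
... | false = D w + b2z (adj G v w)

FireStep : ∀ {m n} → SimpleGraph m n → Divisor m n → Divisor m n → Set
FireStep G D D' = Σ _ λ v → ∀ w → D' w ≡ fire G v D w

_~[_]_ : ∀ {m n} → Divisor m n → SimpleGraph m n → Divisor m n → Set
D ~[ G ] D' = EqClosure (FireStep G) D D'

EquivEffective : ∀ {m n} → SimpleGraph m n → Divisor m n → Set
EquivEffective G D = Σ _ λ D' → Effective D' × (D ~[ G ] D')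

-- The property defining rank ≥ k (k ≥ 0).
RankProp : ∀ {m n} → SimpleGraph m n → Divisor m n → ℕ → Set
RankProp G D k = ∀ E → Effective E → deg E ≡ + k → EquivEffective G (D -ᴰ E)

data IsRank {m n} (G : SimpleGraph m n) (D : Divisor m n) : ℤ → Set where
  rank-neg : ¬ EquivEffective G D → IsRank G D (Data.Integer.-[1+ 0 ])
  rank-nat : ∀ k → EquivEffective G D → RankProp G D k →
             (∀ j → RankProp G D j → j ℕ.≤ k) → IsRank G D (+ k)

rowChips : ∀ {m n} → Divisor m n → Fin n → ℤ
rowChips {m} D y = sumFin m (λ x → D (x , y))

IsPoorestRow : ∀ {m n} → Divisor m n → Fin n → Set
IsPoorestRow D y = ∀ y' → rowChips D y ≤ rowChips D y'

RowEquitable : ∀ {m n} → SimpleGraph m n → Divisor m n → Set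
RowEquitable G D =
  Effective D ×
  (∀ D' → Effective D' → D ~[ G ] D' →
     ∀ y y' → IsPoorestRow D y → IsPoorestRow D' y' → rowChips D' y' ≤ rowChips D y)

burnStep : ∀ {m n} → SimpleGraph m n → Divisor m n → Vtx m n →
           (Vtx m n → Bool) → (Vtx m n → Bool)
burnStep G D q B v =
  B v ∨ (not (does (v ≟V q)) ∧ does (D v <? sumV (λ w → b2z (adj G v w ∧ B w))))

burnIter : ∀ {m n} → SimpleGraph m n → Divisor m n → Vtx m n → ℕ → (Vtx m n → Bool)
burnIter G D q zero    v = does (v ≟V q)
burnIter G D q (suc k) v = burnStep G D q (burnIter G D q k) v

-- v burns (at some stage; the process is monotone and stabilises).
Burns : ∀ {m n} → SimpleGraph m n → Divisor m n → Vtx m n → Vtx m n → Set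
Burns G D q v = ∃ λ k → burnIter G D q k v ≡ true

{-# OPTIONS --safe #-}
-- Let B be the set burnt by Dhar's algorithm and U its complement. An unburnt vertex (x , y) holds at least
-- as many chips as it has neighbours in B, and as a queen it sees all of column x and row y plus a diagonal
-- neighbour. Since the poorest row burns, every column meets B, and summing over U gives
-- deg D ≥ Σ_x u_x b_x + Σ_y u'_y b'_y (+ diagonal contributions), where u + b = n in each column and
-- u' + b' = m in each row, and uv ≥ u + v − 1 for u, v ≥ 1. If some row lies entirely in U, every column is
-- mixed and this already yields (m − 1)n + 2. Otherwise U is nonempty because r(D) > 0 and D(q) = 0, and
-- firing U gives an effective equivalent divisor whose poorest row, by row-equitability, has at most as many
-- chips as the poorest row of D; counting chips on that row shows that every row of D has at least m − 1
-- chips, and the rows meeting U contribute at least two more.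
module Submission where

module QueenChipFiring where

  open import Defs
  open import Data.Bool using (Bool; true; false; _∧_; _∨_; not) renaming (_≟_ to _≟ᵇ_)
  open import Data.Bool.Properties using (¬-not; not-involutive; ∨-conicalʳ; ∧-identityʳ)
  open import Data.Empty using (⊥; ⊥-elim)
  open import Data.Fin using (Fin; zero; suc; toℕ; inject₁)
  import Data.Fin.Properties as Fin
  open import Data.Integer using (ℤ; +_; _+_; _-_; _*_; -_; -1ℤ; _≤_; _<_; _<?_; ∣_∣; +≤+; +<+)
  import Data.Integer.Properties as ℤ
  open import Algebra.Properties.Semiring.Sum ℤ.+-*-semiring
    using (sum; ∑-distrib-+; ∑-comm; *-distribˡ-sum; *-distribʳ-sum)
  open import Data.Integer.Tactic.RingSolver using (solve-∀)
  open import Data.Nat as ℕ using (ℕ; zero; suc; z≤n; s≤s)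
  import Data.Nat.Properties as ℕ
  open import Data.Product using (∃; _×_; _,_; proj₁; proj₂)
  open import Data.Sum using (_⊎_; inj₁; inj₂)
  open import Function using (id; _∘_)
  open import Relation.Binary.Construct.Closure.Equivalence using (fold)
  open import Relation.Binary.Construct.Closure.ReflexiveTransitive using (ε; _◅_; _◅◅_)
  open import Relation.Binary.Construct.Closure.Symmetric using (fwd; bwd)
  open import Relation.Binary.PropositionalEquality
  open import Relation.Binary.Structures using (IsEquivalence)
  open import Relation.Nullary using (¬_; Dec; yes; no; does; ¬?; _×-dec_)
  open import Relation.Nullary.Decidable using (decidable-stable; dec-true; dec-false; map′)

  ⟦_⟧ : ∀ {p} {P : Set p} → Dec P → ℤ
  ⟦ d ⟧ = b2z (does d)

  ⟦⟧-yes : ∀ {p} {P : Set p} (d : Dec P) → P → ⟦ d ⟧ ≡ + 1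
  ⟦⟧-yes (yes _) _ = refl
  ⟦⟧-yes (no ¬p) p = ⊥-elim (¬p p)

  ⟦⟧-no : ∀ {p} {P : Set p} (d : Dec P) → ¬ P → ⟦ d ⟧ ≡ + 0
  ⟦⟧-no (yes p) ¬p = ⊥-elim (¬p p)
  ⟦⟧-no (no _) _ = refl

  does-true⇒ : ∀ {p} {P : Set p} (d : Dec P) → does d ≡ true → P
  does-true⇒ (yes p) _ = p
  does-true⇒ (no _)  ()

  does-false⇒ : ∀ {p} {P : Set p} (d : Dec P) → does d ≡ false → ¬ P
  does-false⇒ (yes _) ()
  does-false⇒ (no ¬p) _ = ¬p

  true≢false : true ≢ false
  true≢false ()

  b2z-nonneg : ∀ b → + 0 ≤ b2z b
  b2z-nonneg true  = +≤+ z≤n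
  b2z-nonneg false = +≤+ z≤n

  b2z-≤1 : ∀ b → b2z b ≤ + 1
  b2z-≤1 true  = +≤+ (s≤s z≤n)
  b2z-≤1 false = +≤+ z≤n

  b2z-not : ∀ b → b2z (not b) + b2z b ≡ + 1
  b2z-not true  = refl
  b2z-not false = refl

  *-nonneg : ∀ {i j} → + 0 ≤ i → + 0 ≤ j → + 0 ≤ i * j
  *-nonneg {+ i} {+ j} _ _ rewrite sym (ℤ.pos-* i j) = +≤+ z≤n

  ≤-+-nonneg : ∀ {i j} → + 0 ≤ j → i ≤ i + j
  ≤-+-nonneg {i} 0≤j = ℤ.≤-trans (ℤ.≤-reflexive (sym (ℤ.+-identityʳ i))) (ℤ.+-monoʳ-≤ i 0≤j)

  ≤-nonneg-+ : ∀ {i j} → + 0 ≤ i → j ≤ i + j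
  ≤-nonneg-+ {i} {j} 0≤i = ℤ.≤-trans (≤-+-nonneg 0≤i) (ℤ.≤-reflexive (ℤ.+-comm j i))

  <⇒1≤- : ∀ {i j} → i < j → + 1 ≤ j - i
  <⇒1≤- {i} {j} i<j = begin
    + 1          ≡⟨ sym (cancel i) ⟩
    + 1 + i - i  ≤⟨ ℤ.+-monoˡ-≤ (- i) (ℤ.i<j⇒suc[i]≤j i<j) ⟩
    j - i        ∎
    where
    open ℤ.≤-Reasoning
    cancel : ∀ i → + 1 + i - i ≡ + 1
    cancel = solve-∀

  ≤-excess : ∀ {e c f} → e + c ≤ f → e ≤ f - c
  ≤-excess {e} {c} {f} e+c≤f = ℤ.≤-trans (ℤ.≤-reflexive (sym (cancel e c))) (ℤ.+-monoˡ-≤ (- c) e+c≤f)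
    where
    cancel : ∀ e c → e + c - c ≡ e
    cancel = solve-∀

  u+v-1≤u*v : ∀ {u v} → + 1 ≤ u → + 1 ≤ v → u + v - + 1 ≤ u * v
  u+v-1≤u*v {u} {v} 1≤u 1≤v = ℤ.≤-trans (≤-+-nonneg (*-nonneg (ℤ.i≤j⇒0≤j-i 1≤u) (ℤ.i≤j⇒0≤j-i 1≤v)))
                                         (ℤ.≤-reflexive (identity u v))
    where
    identity : ∀ u v → u + v - + 1 + (u - + 1) * (v - + 1) ≡ u * v
    identity = solve-∀

  parts-product : ∀ {u v k} → u + v ≡ k → + 1 ≤ u → + 1 ≤ v → k - + 1 ≤ u * v
  parts-product refl = u+v-1≤u*v

  parts-product-shifted : ∀ {u v k} c → u + v ≡ k → + 1 ≤ u → + 0 ≤ v → + 0 ≤ c →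
                          k + c ≤ u * (+ 1 + v + c)
  parts-product-shifted {u} {v} c refl 1≤u 0≤v 0≤c =
    ℤ.≤-trans (ℤ.≤-reflexive (rearrange u v c))
              (u+v-1≤u*v 1≤u (ℤ.≤-trans (≤-+-nonneg 0≤v) (≤-+-nonneg 0≤c)))
    where
    rearrange : ∀ u v c → u + v + c ≡ u + (+ 1 + v + c) - + 1
    rearrange = solve-∀

  sumFin≡sum : ∀ k (f : Fin k → ℤ) → sumFin k f ≡ sum f
  sumFin≡sum zero    f = refl
  sumFin≡sum (suc k) f = cong (_+_ (f zero)) (sumFin≡sum k (f ∘ suc))

  sumFin-cong : ∀ k {f g : Fin k → ℤ} → (∀ i → f i ≡ g i) → sumFin k f ≡ sumFin k g
  sumFin-cong zero    f≗g = refl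
  sumFin-cong (suc k) f≗g = cong₂ _+_ (f≗g zero) (sumFin-cong k (f≗g ∘ suc))

  sumFin-+ : ∀ k (f g : Fin k → ℤ) → sumFin k (λ i → f i + g i) ≡ sumFin k f + sumFin k g
  sumFin-+ k f g = begin
    sumFin k (λ i → f i + g i)  ≡⟨ sumFin≡sum k _ ⟩
    sum (λ i → f i + g i)       ≡⟨ ∑-distrib-+ f g ⟩
    sum f + sum g               ≡⟨ sym (cong₂ _+_ (sumFin≡sum k f) (sumFin≡sum k g)) ⟩
    sumFin k f + sumFin k g     ∎
    where open ≡-Reasoning

  sumFin-*ˡ : ∀ k c (f : Fin k → ℤ) → sumFin k (λ i → c * f i) ≡ c * sumFin k f
  sumFin-*ˡ k c f = begin
    sumFin k (λ i → c * f i)  ≡⟨ sumFin≡sum k _ ⟩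
    sum (λ i → c * f i)       ≡⟨ sym (*-distribˡ-sum c f) ⟩
    c * sum f                 ≡⟨ cong (c *_) (sym (sumFin≡sum k f)) ⟩
    c * sumFin k f            ∎
    where open ≡-Reasoning

  sumFin-*ʳ : ∀ k c (f : Fin k → ℤ) → sumFin k (λ i → f i * c) ≡ sumFin k f * c
  sumFin-*ʳ k c f = begin
    sumFin k (λ i → f i * c)  ≡⟨ sumFin≡sum k _ ⟩
    sum (λ i → f i * c)       ≡⟨ sym (*-distribʳ-sum c f) ⟩
    sum f * c                 ≡⟨ cong (_* c) (sym (sumFin≡sum k f)) ⟩
    sumFin k f * c            ∎
    where open ≡-Reasoning

  sumFin-swap : ∀ k l (f : Fin k → Fin l → ℤ) →
                sumFin k (λ i → sumFin l (f i)) ≡ sumFin l (λ j → sumFin k (λ i → f i j))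
  sumFin-swap k l f = begin
    sumFin k (λ i → sumFin l (f i))          ≡⟨ sumFin-cong k (λ i → sumFin≡sum l (f i)) ⟩
    sumFin k (λ i → sum (f i))               ≡⟨ sumFin≡sum k _ ⟩
    sum (λ i → sum (f i))                    ≡⟨ ∑-comm f ⟩
    sum (λ j → sum (λ i → f i j))            ≡⟨ sym (sumFin≡sum l _) ⟩
    sumFin l (λ j → sum (λ i → f i j))       ≡⟨ sumFin-cong l (λ j → sym (sumFin≡sum k _)) ⟩
    sumFin l (λ j → sumFin k (λ i → f i j))  ∎
    where open ≡-Reasoning

  sumFin-const : ∀ k c → sumFin k (λ _ → c) ≡ + k * c
  sumFin-const zero    c = sym (ℤ.*-zeroˡ c)
  sumFin-const (suc k) c = begin
    c + sumFin k (λ _ → c)  ≡⟨ cong (_+_ c) (sumFin-const k c) ⟩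
    c + + k * c             ≡⟨ cong (_+ + k * c) (sym (ℤ.*-identityˡ c)) ⟩
    + 1 * c + + k * c       ≡⟨ sym (ℤ.*-distribʳ-+ c (+ 1) (+ k)) ⟩
    + suc k * c             ∎
    where open ≡-Reasoning

  sumFin-zero : ∀ k → sumFin k (λ _ → + 0) ≡ + 0
  sumFin-zero k = trans (sumFin-const k (+ 0)) (ℤ.*-zeroʳ (+ k))

  sumFin-mono : ∀ k {f g : Fin k → ℤ} → (∀ i → f i ≤ g i) → sumFin k f ≤ sumFin k g
  sumFin-mono zero    f≤g = ℤ.≤-refl
  sumFin-mono (suc k) f≤g = ℤ.+-mono-≤ (f≤g zero) (sumFin-mono k (f≤g ∘ suc))

  sumFin-mono-< : ∀ k {f g : Fin k → ℤ} → (∀ i → f i ≤ g i) → ∀ j → f j < g j →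
                  sumFin k f < sumFin k g
  sumFin-mono-< (suc k) f≤g zero    fj<gj = ℤ.+-mono-<-≤ fj<gj (sumFin-mono k (f≤g ∘ suc))
  sumFin-mono-< (suc k) f≤g (suc j) fj<gj = ℤ.+-mono-≤-< (f≤g zero) (sumFin-mono-< k (f≤g ∘ suc) j fj<gj)

  sumFin-nonneg : ∀ k {f : Fin k → ℤ} → (∀ i → + 0 ≤ f i) → + 0 ≤ sumFin k f
  sumFin-nonneg k 0≤f = ℤ.≤-trans (ℤ.≤-reflexive (sym (sumFin-zero k))) (sumFin-mono k 0≤f)

  sumFin-supported : ∀ k (f : Fin k → ℤ) (j : Fin k) → (∀ i → i ≢ j → f i ≡ + 0) → sumFin k f ≡ f j
  sumFin-supported (suc k) f zero    f≡0 = begin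
    f zero + sumFin k (f ∘ suc)  ≡⟨ cong (_+_ (f zero)) (sumFin-cong k (λ i → f≡0 (suc i) λ ())) ⟩
    f zero + sumFin k (λ _ → + 0) ≡⟨ cong (_+_ (f zero)) (sumFin-zero k) ⟩
    f zero + + 0                 ≡⟨ ℤ.+-identityʳ (f zero) ⟩
    f zero                       ∎
    where open ≡-Reasoning
  sumFin-supported (suc k) f (suc j) f≡0 = begin
    f zero + sumFin k (f ∘ suc)  ≡⟨ cong (_+ sumFin k (f ∘ suc)) (f≡0 zero λ ()) ⟩
    + 0 + sumFin k (f ∘ suc)     ≡⟨ ℤ.+-identityˡ _ ⟩
    sumFin k (f ∘ suc)           ≡⟨ sumFin-supported k (f ∘ suc) j
                                      (λ i i≢j → f≡0 (suc i) (i≢j ∘ Fin.suc-injective)) ⟩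
    f (suc j)                    ∎
    where open ≡-Reasoning

  term≤sumFin : ∀ k {f : Fin k → ℤ} → (∀ i → + 0 ≤ f i) → ∀ j → f j ≤ sumFin k f
  term≤sumFin (suc k) 0≤f zero    = ≤-+-nonneg (sumFin-nonneg k (0≤f ∘ suc))
  term≤sumFin (suc k) 0≤f (suc j) = ℤ.≤-trans (term≤sumFin k (0≤f ∘ suc) j) (≤-nonneg-+ (0≤f zero))

  two-terms≤sumFin : ∀ k {f : Fin k → ℤ} → (∀ i → + 0 ≤ f i) → ∀ i j → i ≢ j → f i + f j ≤ sumFin k f
  two-terms≤sumFin (suc k) 0≤f zero    zero    0≢0 = ⊥-elim (0≢0 refl)
  two-terms≤sumFin (suc k) {f} 0≤f zero    (suc j) _ = ℤ.+-monoʳ-≤ (f zero) (term≤sumFin k (0≤f ∘ suc) j)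
  two-terms≤sumFin (suc k) {f} 0≤f (suc i) zero    _ =
    ℤ.≤-trans (ℤ.≤-reflexive (ℤ.+-comm (f (suc i)) (f zero)))
              (ℤ.+-monoʳ-≤ (f zero) (term≤sumFin k (0≤f ∘ suc) i))
  two-terms≤sumFin (suc k) 0≤f (suc i) (suc j) i≢j =
    ℤ.≤-trans (two-terms≤sumFin k (0≤f ∘ suc) i j (i≢j ∘ cong suc)) (≤-nonneg-+ (0≤f zero))

  sumFin-δ : ∀ k (j : Fin k) (h : Fin k → ℤ) → sumFin k (λ i → ⟦ i Fin.≟ j ⟧ * h i) ≡ h j
  sumFin-δ k j h = trans (sumFin-supported k _ j (λ i i≢j → cong (_* h i) (⟦⟧-no (i Fin.≟ j) i≢j)))
                         (trans (cong (_* h j) (⟦⟧-yes (j Fin.≟ j) refl)) (ℤ.*-identityˡ (h j)))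

  excess-sum : ∀ k (f : Fin k → ℤ) c e → e ≤ sumFin k (λ i → f i - c) → + k * c + e ≤ sumFin k f
  excess-sum k f c e e≤excess = begin
    + k * c + e                                    ≤⟨ ℤ.+-monoʳ-≤ (+ k * c) e≤excess ⟩
    + k * c + sumFin k (λ i → f i - c)             ≡⟨ cong (_+ sumFin k (λ i → f i - c)) (sym (sumFin-const k c)) ⟩
    sumFin k (λ _ → c) + sumFin k (λ i → f i - c)  ≡⟨ sym (sumFin-+ k _ _) ⟩
    sumFin k (λ i → c + (f i - c))                 ≡⟨ sumFin-cong k (λ i → cancel c (f i)) ⟩
    sumFin k f                                     ∎
    where
    open ℤ.≤-Reasoning
    cancel : ∀ c x → c + (x - c) ≡ x
    cancel = solve-∀

  module _ {m n : ℕ} where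

    sumV-cong : {f g : Vtx m n → ℤ} → (∀ v → f v ≡ g v) → sumV f ≡ sumV g
    sumV-cong f≗g = sumFin-cong m (λ x → sumFin-cong n (λ y → f≗g (x , y)))

    sumV-+ : (f g : Vtx m n → ℤ) → sumV (λ v → f v + g v) ≡ sumV f + sumV g
    sumV-+ f g = trans (sumFin-cong m (λ x → sumFin-+ n _ _)) (sumFin-+ m _ _)

    sumV-*ˡ : ∀ c (f : Vtx m n → ℤ) → sumV (λ v → c * f v) ≡ c * sumV f
    sumV-*ˡ c f = trans (sumFin-cong m (λ x → sumFin-*ˡ n c _)) (sumFin-*ˡ m c _)

    sumV-zero : sumV {m} {n} (λ _ → + 0) ≡ + 0
    sumV-zero = trans (sumFin-cong m (λ _ → sumFin-zero n)) (sumFin-zero m)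

    sumV-mono : {f g : Vtx m n → ℤ} → (∀ v → f v ≤ g v) → sumV f ≤ sumV g
    sumV-mono f≤g = sumFin-mono m (λ x → sumFin-mono n (λ y → f≤g (x , y)))

    sumV-mono-< : {f g : Vtx m n → ℤ} → (∀ v → f v ≤ g v) → ∀ v → f v < g v → sumV f < sumV g
    sumV-mono-< f≤g (x , y) lt =
      sumFin-mono-< m (λ x → sumFin-mono n (λ y → f≤g (x , y))) x (sumFin-mono-< n (λ y → f≤g (x , y)) y lt)

    sumV-nonneg : {f : Vtx m n → ℤ} → (∀ v → + 0 ≤ f v) → + 0 ≤ sumV f
    sumV-nonneg 0≤f = sumFin-nonneg m (λ x → sumFin-nonneg n (λ y → 0≤f (x , y)))

    sumV-supported : (f : Vtx m n → ℤ) (v : Vtx m n) → (∀ u → u ≢ v → f u ≡ + 0) → sumV f ≡ f v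
    sumV-supported f (x₀ , y₀) f≡0 =
      trans (sumFin-supported m _ x₀ (λ x x≢x₀ →
               trans (sumFin-cong n (λ y → f≡0 (x , y) (x≢x₀ ∘ cong proj₁))) (sumFin-zero n)))
            (sumFin-supported n _ y₀ (λ y y≢y₀ → f≡0 (x₀ , y) (y≢y₀ ∘ cong proj₂)))

    term≤sumV : {f : Vtx m n → ℤ} → (∀ v → + 0 ≤ f v) → ∀ v → f v ≤ sumV f
    term≤sumV 0≤f (x , y) = ℤ.≤-trans (term≤sumFin n (λ y → 0≤f (x , y)) y)
                                      (term≤sumFin m (λ x → sumFin-nonneg n (λ y → 0≤f (x , y))) x)

    δ : Vtx m n → Vtx m n → ℤ
    δ v u = ⟦ u ≟V v ⟧

    sumV-δ : (h : Vtx m n → ℤ) (v : Vtx m n) → sumV (λ u → δ v u * h u) ≡ h v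
    sumV-δ h v = trans (sumV-supported _ v (λ u u≢v → cong (_* h u) (⟦⟧-no (u ≟V v) u≢v)))
                       (trans (cong (_* h v) (⟦⟧-yes (v ≟V v) refl)) (ℤ.*-identityˡ (h v)))

  anyV? : ∀ {m n} {P : Vtx m n → Set} → (∀ v → Dec (P v)) → Dec (∃ P)
  anyV? P? = map′ (λ (x , y , p) → (x , y) , p) (λ ((x , y) , p) → x , y , p)
                  (Fin.any? (λ x → Fin.any? (λ y → P? (x , y))))

  argmaxFin : ∀ k (f : Fin (suc k) → ℤ) → ∃ λ j → ∀ i → f i ≤ f j
  argmaxFin zero    f = zero , λ { zero → ℤ.≤-refl }
  argmaxFin (suc k) f with argmaxFin k (f ∘ suc)
  ... | j , f≤fj with f zero ℤ.≤? f (suc j)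
  ...   | yes f0≤fj = suc j , λ { zero → f0≤fj ; (suc i) → f≤fj i }
  ...   | no  f0≰fj = zero , λ { zero → ℤ.≤-refl ; (suc i) → ℤ.≤-trans (f≤fj i) (ℤ.<⇒≤ (ℤ.≰⇒> f0≰fj)) }

  argmaxV : ∀ {m n} → Vtx m n → (f : Vtx m n → ℤ) → ∃ λ v → ∀ u → f u ≤ f v
  argmaxV {suc k} {suc l} _ f with argmaxFin k (λ x → f (x , proj₁ (argmaxFin l (λ y → f (x , y)))))
  ... | x₀ , ≤x₀ = (x₀ , proj₁ (argmaxFin l (λ y → f (x₀ , y)))) ,
                   λ (x , y) → ℤ.≤-trans (proj₂ (argmaxFin l (λ y → f (x , y))) y) (≤x₀ x)

  -- Abstract, so that the typechecker never evaluates the witness, which compares symbolic row sums.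
  abstract
    poorest-row-exists : ∀ {m k} (D : Divisor m (suc k)) → ∃ (IsPoorestRow D)
    poorest-row-exists {k = k} D with argmaxFin k (λ y → - rowChips D y)
    ... | y , -≤-y = y , λ y' → ℤ.neg-cancel-≤ (-≤-y y')

  -- Firing scripts and the Laplacian

  module _ {m n : ℕ} (G : SimpleGraph m n) where

    laplacian : (Vtx m n → ℤ) → Divisor m n
    laplacian f w = sumV (λ u → b2z (adj G w u) * (f w - f u))

    laplacian-cong : ∀ {f g} → (∀ v → f v ≡ g v) → ∀ w → laplacian f w ≡ laplacian g w
    laplacian-cong f≗g w = sumV-cong (λ u → cong₂ (λ a b → b2z (adj G w u) * (a - b)) (f≗g w) (f≗g u))

    laplacian-+ : ∀ f g w → laplacian (λ v → f v + g v) w ≡ laplacian f w + laplacian g w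
    laplacian-+ f g w =
      trans (sumV-cong (λ u → distrib (b2z (adj G w u)) (f w) (g w) (f u) (g u))) (sumV-+ {m} {n} _ _)
      where
      distrib : ∀ a b c d e → a * ((b + c) - (d + e)) ≡ a * (b - d) + a * (c - e)
      distrib = solve-∀

    laplacian-*ˡ : ∀ c f w → laplacian (λ v → c * f v) w ≡ c * laplacian f w
    laplacian-*ˡ c f w = trans (sumV-cong (λ u → factor c (b2z (adj G w u)) (f w) (f u))) (sumV-*ˡ {m} {n} c _)
      where
      factor : ∀ c a b d → a * (c * b - c * d) ≡ c * (a * (b - d))
      factor = solve-∀

    laplacian-neg : ∀ f w → laplacian (λ v → - f v) w ≡ - laplacian f w
    laplacian-neg f w = begin
      laplacian (λ v → - f v) w     ≡⟨ laplacian-cong (λ v → sym (ℤ.-1*i≡-i (f v))) w ⟩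
      laplacian (λ v → -1ℤ * f v) w ≡⟨ laplacian-*ˡ -1ℤ f w ⟩
      -1ℤ * laplacian f w           ≡⟨ ℤ.-1*i≡-i _ ⟩
      - laplacian f w               ∎
      where open ≡-Reasoning

    laplacian-zero : ∀ w → laplacian (λ _ → + 0) w ≡ + 0
    laplacian-zero w = trans (sumV-cong (λ u → ℤ.*-zeroʳ (b2z (adj G w u)))) (sumV-zero {m} {n})

    laplacian-δ-self : ∀ v → laplacian (δ v) v ≡ valence G v
    laplacian-δ-self v = sumV-cong term
      where
      term : ∀ u → b2z (adj G v u) * (δ v v - δ v u) ≡ b2z (adj G v u)
      term u with u ≟V v
      ... | yes refl rewrite adj-irrefl G u = refl
      ... | no _ rewrite ⟦⟧-yes (v ≟V v) refl = ℤ.*-identityʳ _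

    laplacian-δ-other : ∀ v w → w ≢ v → laplacian (δ v) w ≡ - b2z (adj G v w)
    laplacian-δ-other v w w≢v = begin
      laplacian (δ v) w                    ≡⟨ sumV-supported _ v vanishes ⟩
      b2z (adj G w v) * (δ v w - δ v v)    ≡⟨ cong₂ (λ s t → b2z (adj G w v) * (s - t))
                                                    (⟦⟧-no (w ≟V v) w≢v) (⟦⟧-yes (v ≟V v) refl) ⟩
      b2z (adj G w v) * (+ 0 - + 1)        ≡⟨ times-minus-one (b2z (adj G w v)) ⟩
      - b2z (adj G w v)                    ≡⟨ cong (-_ ∘ b2z) (adj-sym G w v) ⟩
      - b2z (adj G v w)                    ∎
      where
      open ≡-Reasoning
      times-minus-one : ∀ a → a * (+ 0 - + 1) ≡ - a
      times-minus-one = solve-∀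
      vanishes : ∀ u → u ≢ v → b2z (adj G w u) * (δ v w - δ v u) ≡ + 0
      vanishes u u≢v rewrite ⟦⟧-no (w ≟V v) w≢v | ⟦⟧-no (u ≟V v) u≢v = ℤ.*-zeroʳ (b2z (adj G w u))

    fire-self : ∀ v D → fire G v D v ≡ D v - valence G v
    fire-self v D with v ≟V v
    ... | yes _   = refl
    ... | no v≢v = ⊥-elim (v≢v refl)

    fire-other : ∀ v D w → w ≢ v → fire G v D w ≡ D w + b2z (adj G v w)
    fire-other v D w w≢v with w ≟V v
    ... | yes w≡v = ⊥-elim (w≢v w≡v)
    ... | no _    = refl

    fire≡-laplacian : ∀ v D w → fire G v D w ≡ D w - laplacian (δ v) w
    fire≡-laplacian v D w = by-cases (w ≟V v)
      where
      by-cases : Dec (w ≡ v) → fire G v D w ≡ D w - laplacian (δ v) w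
      by-cases (yes refl) = trans (fire-self w D) (cong (_-_ (D w)) (sym (laplacian-δ-self w)))
      by-cases (no w≢v)   = trans (fire-other v D w w≢v)
        (cong (_+_ (D w)) (sym (trans (cong -_ (laplacian-δ-other v w w≢v)) (ℤ.neg-involutive _))))

    LinEquiv : Divisor m n → Divisor m n → Set
    LinEquiv D D' = ∃ λ f → ∀ w → D' w ≡ D w - laplacian f w

    LinEquiv-isEquivalence : IsEquivalence LinEquiv
    LinEquiv-isEquivalence = record
      { refl  = λ {D} → (λ _ → + 0) , λ w →
                  sym (trans (cong (_-_ (D w)) (laplacian-zero w)) (ℤ.+-identityʳ (D w)))
      ; sym   = λ {D} {D'} (f , D'≗) → (λ v → - f v) , λ w →
                  trans (back (D w) (D' w) (laplacian f w) (D'≗ w)) (cong (_-_ (D' w)) (sym (laplacian-neg f w)))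
      ; trans = λ {D} {D'} {D''} (f , D'≗) (g , D''≗) → (λ v → f v + g v) , λ w →
                  trans (D''≗ w) (trans (cong (_- laplacian g w) (D'≗ w))
                    (trans (sub-sub (D w) (laplacian f w) (laplacian g w))
                           (cong (_-_ (D w)) (sym (laplacian-+ f g w)))))
      }
      where
      back : ∀ a b c → b ≡ a - c → a ≡ b - - c
      back a _ c refl = cancel a c
        where
        cancel : ∀ a c → a ≡ a - c - - c
        cancel = solve-∀
      sub-sub : ∀ a b c → a - b - c ≡ a - (b + c)
      sub-sub = solve-∀

    ~⇒LinEquiv : ∀ {D D'} → D ~[ G ] D' → LinEquiv D D'
    ~⇒LinEquiv = fold LinEquiv-isEquivalence
                      (λ { {D} (v , D'≗) → δ v , λ w → trans (D'≗ w) (fire≡-laplacian v D w) })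

    Fireable : (Vtx m n → ℤ) → Set
    Fireable f = ∀ D D' → (∀ w → D' w ≡ D w - laplacian f w) → D ~[ G ] D'

    fire-cong : ∀ v {D D'} → (∀ w → D w ≡ D' w) → ∀ w → fire G v D w ≡ fire G v D' w
    fire-cong v {D} {D'} D≗D' w = begin
      fire G v D w                 ≡⟨ fire≡-laplacian v D w ⟩
      D w - laplacian (δ v) w      ≡⟨ cong (_- laplacian (δ v) w) (D≗D' w) ⟩
      D' w - laplacian (δ v) w     ≡⟨ sym (fire≡-laplacian v D' w) ⟩
      fire G v D' w                ∎
      where open ≡-Reasoning

    -- The closure has no step for pointwise equality, so fire some vertex and fire it back.
    ≗⇒~ : Vtx m n → ∀ {D D'} → (∀ w → D' w ≡ D w) → D ~[ G ] D'
    ≗⇒~ v {D} {D'} D'≗D = fwd (v , λ _ → refl) ◅ bwd (v , fire-cong v (sym ∘ D'≗D)) ◅ ε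

    fireable-zero : Vtx m n → Fireable (λ _ → + 0)
    fireable-zero v₀ D D' D'≗ =
      ≗⇒~ v₀ (λ w → trans (D'≗ w) (trans (cong (_-_ (D w)) (laplacian-zero w)) (ℤ.+-identityʳ (D w))))

    fireable-δ : ∀ v → Fireable (δ v)
    fireable-δ v D D' D'≗ = fwd (v , λ w → trans (D'≗ w) (sym (fire≡-laplacian v D w))) ◅ ε

    fireable-cong : ∀ {f g} → (∀ v → f v ≡ g v) → Fireable f → Fireable g
    fireable-cong f≗g fire-f D D' D'≗ =
      fire-f D D' (λ w → trans (D'≗ w) (cong (_-_ (D w)) (sym (laplacian-cong f≗g w))))

    fireable-+ : ∀ {f g} → Fireable f → Fireable g → Fireable (λ v → f v + g v)
    fireable-+ {f} {g} fire-f fire-g D D' D'≗ =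
      fire-f D (D -ᴰ laplacian f) (λ _ → refl) ◅◅ fire-g (D -ᴰ laplacian f) D' (λ w →
        trans (D'≗ w) (trans (cong (_-_ (D w)) (laplacian-+ f g w)) (sub-+ (D w) (laplacian f w) (laplacian g w))))
      where
      sub-+ : ∀ a b c → a - (b + c) ≡ a - b - c
      sub-+ = solve-∀

    fireable-sumFin : Vtx m n → ∀ k (f : Fin k → Vtx m n → ℤ) → (∀ i → Fireable (f i)) →
                      Fireable (λ v → sumFin k (λ i → f i v))
    fireable-sumFin v₀ zero    f fire-f = fireable-zero v₀
    fireable-sumFin v₀ (suc k) f fire-f =
      fireable-+ {f zero} (fire-f zero) (fireable-sumFin v₀ k (f ∘ suc) (fire-f ∘ suc))

    fireable-set : Vtx m n → (S : Vtx m n → Bool) → Fireable (b2z ∘ S)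
    fireable-set v₀ S = fireable-cong sum-at all-members
      where
      sum-at : ∀ w → sumV (λ v → b2z (S v) * δ v w) ≡ b2z (S w)
      sum-at w = trans (sumV-supported _ w vanishes)
                       (trans (cong (_*_ (b2z (S w))) (⟦⟧-yes (w ≟V w) refl)) (ℤ.*-identityʳ _))
        where
        vanishes : ∀ v → v ≢ w → b2z (S v) * δ v w ≡ + 0
        vanishes v v≢w = trans (cong (_*_ (b2z (S v))) (⟦⟧-no (w ≟V v) (v≢w ∘ sym))) (ℤ.*-zeroʳ (b2z (S v)))
      member : ∀ b v → Fireable (λ w → b2z b * δ v w)
      member true  v = fireable-cong (λ w → sym (ℤ.*-identityˡ (δ v w))) (fireable-δ v)
      member false v = fireable-zero v₀
      all-members : Fireable (λ w → sumV (λ v → b2z (S v) * δ v w))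
      all-members = fireable-sumFin v₀ m _ (λ x → fireable-sumFin v₀ n _ (λ y → member (S (x , y)) (x , y)))

    rank⇒chips-at : ∀ {D} k v → RankProp G D k →
                    ∃ λ f → Effective (D -ᴰ laplacian f) × + k ≤ D v - laplacian f v
    rank⇒chips-at {D} k v remove = f , effective , chips-at-v
      where
      E : Divisor m n
      E w = + k * δ v w
      E-effective : Effective E
      E-effective w = *-nonneg {+ k} {δ v w} (+≤+ z≤n) (b2z-nonneg (does (w ≟V v)))
      E-at-v : E v ≡ + k
      E-at-v = trans (cong (_*_ (+ k)) (⟦⟧-yes (v ≟V v) refl)) (ℤ.*-identityʳ (+ k))
      deg-E : deg E ≡ + k
      deg-E = begin
        sumV (λ w → + k * δ v w)  ≡⟨ sumV-*ˡ (+ k) (δ v) ⟩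
        + k * sumV (δ v)          ≡⟨ cong (_*_ (+ k)) (sumV-supported (δ v) v (λ u → ⟦⟧-no (u ≟V v))) ⟩
        + k * δ v v               ≡⟨ E-at-v ⟩
        + k                       ∎
        where open ≡-Reasoning
      equivalent : EquivEffective G (D -ᴰ E)
      equivalent = remove E E-effective deg-E
      script : LinEquiv (D -ᴰ E) (proj₁ equivalent)
      script = ~⇒LinEquiv (proj₂ (proj₂ equivalent))
      f : Vtx m n → ℤ
      f = proj₁ script
      split : ∀ w → D w - laplacian f w ≡ proj₁ equivalent w + E w
      split w = trans (add-back (D w) (E w) (laplacian f w)) (cong (_+ E w) (sym (proj₂ script w)))
        where
        add-back : ∀ d e l → d - l ≡ d - e - l + e
        add-back = solve-∀
      effective : Effective (D -ᴰ laplacian f)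
      effective w = ℤ.≤-trans (ℤ.+-mono-≤ (proj₁ (proj₂ equivalent) w) (E-effective w))
                              (ℤ.≤-reflexive (sym (split w)))
      chips-at-v : + k ≤ D v - laplacian f v
      chips-at-v = ℤ.≤-trans (ℤ.≤-trans (ℤ.≤-reflexive (sym E-at-v)) (≤-nonneg-+ (proj₁ (proj₂ equivalent) v)))
                             (ℤ.≤-reflexive (sym (split v)))

    neighboursIn : (Vtx m n → Bool) → Vtx m n → ℤ
    neighboursIn S v = sumV (λ w → b2z (adj G v w ∧ S w))

    neighboursIn-nonneg : ∀ S w → + 0 ≤ neighboursIn S w
    neighboursIn-nonneg S w = sumV-nonneg (λ v → b2z-nonneg (adj G w v ∧ S v))

    neighboursIn-cong : ∀ {S S'} → (∀ v → S v ≡ S' v) → ∀ w → neighboursIn S w ≡ neighboursIn S' w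
    neighboursIn-cong S≗S' w = sumV-cong (λ v → cong (λ s → b2z (adj G w v ∧ s)) (S≗S' v))

    laplacian-indicator-outside : ∀ S w → S w ≡ false → laplacian (b2z ∘ S) w ≡ - neighboursIn S w
    laplacian-indicator-outside S w off = begin
      laplacian (b2z ∘ S) w                      ≡⟨ sumV-cong term ⟩
      sumV (λ v → -1ℤ * b2z (adj G w v ∧ S v))   ≡⟨ sumV-*ˡ -1ℤ (λ v → b2z (adj G w v ∧ S v)) ⟩
      -1ℤ * neighboursIn S w                     ≡⟨ ℤ.-1*i≡-i (neighboursIn S w) ⟩
      - neighboursIn S w                         ∎
      where
      open ≡-Reasoning
      term : ∀ v → b2z (adj G w v) * (b2z (S w) - b2z (S v)) ≡ -1ℤ * b2z (adj G w v ∧ S v)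
      term v rewrite off with adj G w v | S v
      ... | true  | true  = refl
      ... | true  | false = refl
      ... | false | _     = refl

    laplacian-indicator-inside : ∀ S w → S w ≡ true → laplacian (b2z ∘ S) w ≡ neighboursIn (not ∘ S) w
    laplacian-indicator-inside S w on = sumV-cong term
      where
      term : ∀ v → b2z (adj G w v) * (b2z (S w) - b2z (S v)) ≡ b2z (adj G w v ∧ not (S v))
      term v rewrite on with adj G w v | S v
      ... | true  | true  = refl
      ... | true  | false = refl
      ... | false | _     = refl

    laplacian-at-max-nonneg : ∀ f v → (∀ u → f u ≤ f v) → + 0 ≤ laplacian f v
    laplacian-at-max-nonneg f v f≤fv = sumV-nonneg term
      where
      term : ∀ u → + 0 ≤ b2z (adj G v u) * (f v - f u)
      term u = *-nonneg (b2z-nonneg (adj G v u)) (ℤ.i≤j⇒0≤j-i (f≤fv u))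

    neighbours-below-max≤laplacian : ∀ f v S → (∀ u → f u ≤ f v) → (∀ u → S u ≡ true → f u < f v) →
                                     neighboursIn S v ≤ laplacian f v
    neighbours-below-max≤laplacian f v S f≤fv below = sumV-mono term
      where
      term : ∀ u → b2z (adj G v u ∧ S u) ≤ b2z (adj G v u) * (f v - f u)
      term u with adj G v u | S u in Su
      ... | false | _     = ℤ.≤-refl
      ... | true  | false = ℤ.≤-trans (ℤ.i≤j⇒0≤j-i (f≤fv u)) (ℤ.≤-reflexive (sym (ℤ.*-identityˡ _)))
      ... | true  | true  = ℤ.≤-trans (<⇒1≤- (below u Su)) (ℤ.≤-reflexive (sym (ℤ.*-identityˡ _)))

  -- Dhar's burning algorithm

  module Burning {m n : ℕ} (G : SimpleGraph m n) (D : Divisor m n) (q : Vtx m n) where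

    stage : ℕ → Vtx m n → Bool
    stage = burnIter G D q

    catches : ℕ → Vtx m n → Bool
    catches k v = not (does (v ≟V q)) ∧ does (D v <? neighboursIn G (stage k) v)

    stage-suc : ∀ k v → stage k v ≡ true → stage (suc k) v ≡ true
    stage-suc k v on = cong (_∨ catches k v) on

    stage-mono : ∀ {k l} → k ℕ.≤ l → ∀ v → stage k v ≡ true → stage l v ≡ true
    stage-mono {k} k≤l v = go (ℕ.≤⇒≤′ k≤l)
      where
      go : ∀ {l} → k ℕ.≤′ l → stage k v ≡ true → stage l v ≡ true
      go ℕ.≤′-refl           = id
      go (ℕ.≤′-step {l} p) = stage-suc l v ∘ go p

    ignites : ∀ j v → stage j v ≡ false → stage (suc j) v ≡ true → D v < neighboursIn G (stage j) v
    ignites j v off on = does-true⇒ (D v <? _) (right-disjunct off on)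
      where
      right-disjunct : ∀ {a b c} → a ≡ false → a ∨ (b ∧ c) ≡ true → c ≡ true
      right-disjunct {false} {true}  _ c≡true = c≡true
      right-disjunct {false} {false} _ ()
      right-disjunct {true}          ()

    first-to-burn : (P : Vtx m n → Set) → (∀ v → Dec (P v)) → ¬ P q → ∀ k v → P v → stage k v ≡ true →
                    ∃ λ j → ∃ λ v → P v × stage (suc j) v ≡ true × (∀ u → P u → stage j u ≡ false)
    first-to-burn P P? ¬Pq zero    v Pv on = ⊥-elim (¬Pq (subst P (does-true⇒ (v ≟V q) on) Pv))
    first-to-burn P P? ¬Pq (suc k) v Pv on with anyV? (λ u → P? u ×-dec (stage k u ≟ᵇ true))
    ... | yes (u , Pu , on-u) = first-to-burn P P? ¬Pq k u Pu on-u
    ... | no  none            = k , v , Pv , on , λ u Pu → ¬-not (λ on-u → none (u , Pu , on-u))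

    size : (Vtx m n → Bool) → ℤ
    size S = sumV (b2z ∘ S)

    Stable : ℕ → Set
    Stable k = ∀ v → stage (suc k) v ≡ stage k v

    size-grows : ∀ k v → stage (suc k) v ≢ stage k v → size (stage k) < size (stage (suc k))
    size-grows k v changed = sumV-mono-< (λ u → b2z-mono (stage-suc k u)) v (strict (stage-suc k v) changed)
      where
      b2z-mono : ∀ {a b} → (a ≡ true → b ≡ true) → b2z a ≤ b2z b
      b2z-mono {false} _ = b2z-nonneg _
      b2z-mono {true} a⇒b rewrite a⇒b refl = ℤ.≤-refl
      strict : ∀ {a b} → (a ≡ true → b ≡ true) → b ≢ a → b2z a < b2z b
      strict {false} {false} _ b≢a = ⊥-elim (b≢a refl)
      strict {false} {true}  _ _   = +<+ (s≤s z≤n)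
      strict {true}  a⇒b b≢a       = ⊥-elim (b≢a (a⇒b refl))

    stable-or-large : ∀ k → ∃ Stable ⊎ + k < size (stage k)
    stable-or-large zero = inj₂ (ℤ.<-≤-trans (+<+ (s≤s z≤n))
                                  (ℤ.≤-trans (ℤ.≤-reflexive (cong b2z (sym (dec-true (q ≟V q) refl))))
                                             (term≤sumV (b2z-nonneg ∘ stage 0) q)))
    stable-or-large (suc k) with stable-or-large k
    ... | inj₁ stable = inj₁ stable
    ... | inj₂ large with anyV? (λ v → ¬? (stage (suc k) v ≟ᵇ stage k v))
    ...   | yes (v , changed) = inj₂ (ℤ.≤-<-trans (ℤ.i<j⇒suc[i]≤j large) (size-grows k v changed))
    ...   | no  unchanged     =
      inj₁ (k , λ v → decidable-stable (stage (suc k) v ≟ᵇ stage k v) (λ ne → unchanged (v , ne)))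

    -- Abstract, so that the typechecker never tries to run the burning process.
    abstract
      stabilises : ∃ Stable
      stabilises with stable-or-large ∣ size (λ _ → true) ∣
      ... | inj₁ stable = stable
      ... | inj₂ large  = ⊥-elim (ℤ.<-irrefl refl (begin-strict
        size (λ _ → true)                         ≡⟨ sym (ℤ.0≤i⇒+∣i∣≡i (sumV-nonneg {m} {n} (λ _ → +≤+ z≤n))) ⟩
        + ∣ size (λ _ → true) ∣                  <⟨ large ⟩
        size (stage ∣ size (λ _ → true) ∣)       ≤⟨ sumV-mono {m} {n} (λ v → b2z-≤1 (stage ∣ size (λ _ → true) ∣ v)) ⟩
        size (λ _ → true)                         ∎))
        where open ℤ.≤-Reasoning


    burnt : Vtx m n → Bool
    burnt = stage (proj₁ stabilises)

    stage-eventually : ∀ {l} → proj₁ stabilises ℕ.≤ l → ∀ v → stage l v ≡ burnt v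
    stage-eventually J≤l = go (ℕ.≤⇒≤′ J≤l)
      where
      go : ∀ {l} → proj₁ stabilises ℕ.≤′ l → ∀ v → stage l v ≡ burnt v
      go ℕ.≤′-refl     v = refl
      go (ℕ.≤′-step p) v = trans (cong₂ (λ b s → b ∨ (not (does (v ≟V q)) ∧ does (D v <? s))) (go p v)
                                        (sumV-cong (λ w → cong (λ b → b2z (adj G v w ∧ b)) (go p w))))
                                 (proj₂ stabilises v)

    burns⇒burnt : ∀ v → Burns G D q v → burnt v ≡ true
    burns⇒burnt v (k , on) with k ℕ.≤? proj₁ stabilises
    ... | yes k≤J = stage-mono k≤J v on
    ... | no  k≰J = trans (sym (stage-eventually (ℕ.<⇒≤ (ℕ.≰⇒> k≰J)) v)) on

    burnt-q : burnt q ≡ true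
    burnt-q = stage-mono {l = proj₁ stabilises} z≤n q (dec-true (q ≟V q) refl)

    unburnt-stable : ∀ v → burnt v ≡ false → neighboursIn G burnt v ≤ D v
    unburnt-stable v off =
      ℤ.≮⇒≥ (does-false⇒ (D v <? _) (right-conjunct (cong not (dec-false (v ≟V q) v≢q)) blocked))
      where
      v≢q : v ≢ q
      v≢q v≡q = true≢false (trans (sym burnt-q) (subst (λ u → burnt u ≡ false) v≡q off))
      blocked : catches (proj₁ stabilises) v ≡ false
      blocked = ∨-conicalʳ (burnt v) _ (trans (proj₂ stabilises v) off)
      right-conjunct : ∀ {a c} → a ≡ true → a ∧ c ≡ false → c ≡ false
      right-conjunct refl c≡false = c≡false

    all-burnt⇒reduced : ∀ K → (∀ v → stage K v ≡ true) → D q ≡ + 0 →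
                        ∀ f → Effective (D -ᴰ laplacian G f) → (D -ᴰ laplacian G f) q ≤ + 0
    all-burnt⇒reduced K all-on Dq≡0 f effective with argmaxV q f
    ... | top , f≤top with f q ℤ.≟ f top
    ...   | yes q-top = begin
      D q - laplacian G f q    ≡⟨ cong (_- laplacian G f q) Dq≡0 ⟩
      + 0 - laplacian G f q    ≡⟨ ℤ.+-identityˡ _ ⟩
      - laplacian G f q        ≤⟨ ℤ.neg-mono-≤ (laplacian-at-max-nonneg G f q f≤q) ⟩
      + 0                      ∎
      where
      open ℤ.≤-Reasoning
      f≤q : ∀ u → f u ≤ f q
      f≤q u = ℤ.≤-trans (f≤top u) (ℤ.≤-reflexive (sym q-top))
    ...   | no q-not-top
      with first-to-burn (λ v → f v ≡ f top) (λ v → f v ℤ.≟ f top) q-not-top K top refl (all-on top)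
    ...     | j , v , v-top , on , tops-off = ⊥-elim (ℤ.<⇒≱ (begin-strict
      D v                          <⟨ ignites j v (tops-off v v-top) on ⟩
      neighboursIn G (stage j) v   ≤⟨ neighbours-below-max≤laplacian G f v (stage j) f≤v below ⟩
      laplacian G f v              ∎) (ℤ.0≤i-j⇒j≤i (effective v)))
      where
      open ℤ.≤-Reasoning
      f≤v : ∀ u → f u ≤ f v
      f≤v u = ℤ.≤-trans (f≤top u) (ℤ.≤-reflexive (sym v-top))
      below : ∀ u → stage j u ≡ true → f u < f v
      below u on-u = ℤ.≤∧≢⇒< (f≤v u)
                              (λ fu≡fv → true≢false (trans (sym on-u) (tops-off u (trans fu≡fv v-top))))

    positive-rank⇒unburnt : ∀ {r} → IsRank G D r → + 0 < r → D q ≡ + 0 → ∃ λ v → burnt v ≡ false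
    positive-rank⇒unburnt rank 0<r Dq≡0 with anyV? (λ v → burnt v ≟ᵇ false)
    ... | yes found = found
    ... | no  none  = ⊥-elim (no-chip-on-q rank 0<r)
      where
      all-on : ∀ v → burnt v ≡ true
      all-on v = ¬-not (λ off → none (v , off))
      no-chip-on-q : ∀ {r} → IsRank G D r → + 0 < r → ⊥
      no-chip-on-q (rank-neg _)                   ()
      no-chip-on-q (rank-nat zero _ _ _)          (+<+ ())
      no-chip-on-q (rank-nat (suc k) _ remove _) _ =
        let f , effective , k≤Dq = rank⇒chips-at G {D} (suc k) q remove
        in ℤ.≤⇒≯ (ℤ.≤-trans k≤Dq (all-burnt⇒reduced (proj₁ stabilises) all-on Dq≡0 f effective))
                  (+<+ (s≤s z≤n))

  rowCount : ∀ {m n} → (Vtx m n → Bool) → Fin n → ℤ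
  rowCount {m} S y = sumFin m (λ x → b2z (S (x , y)))

  colCount : ∀ {m n} → (Vtx m n → Bool) → Fin m → ℤ
  colCount {n = n} S x = sumFin n (λ y → b2z (S (x , y)))

  count-nonneg : ∀ k (s : Fin k → Bool) → + 0 ≤ sumFin k (b2z ∘ s)
  count-nonneg k s = sumFin-nonneg k (b2z-nonneg ∘ s)

  count-pos : ∀ k (s : Fin k → Bool) i → s i ≡ true → + 1 ≤ sumFin k (b2z ∘ s)
  count-pos k s i on = ℤ.≤-trans (ℤ.≤-reflexive (cong b2z (sym on))) (term≤sumFin k (b2z-nonneg ∘ s) i)

  count-complement : ∀ k (s : Fin k → Bool) → sumFin k (b2z ∘ not ∘ s) + sumFin k (b2z ∘ s) ≡ + k
  count-complement k s = begin
    sumFin k (b2z ∘ not ∘ s) + sumFin k (b2z ∘ s)  ≡⟨ sym (sumFin-+ k _ _) ⟩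
    sumFin k (λ i → b2z (not (s i)) + b2z (s i))   ≡⟨ sumFin-cong k (b2z-not ∘ s) ⟩
    sumFin k (λ _ → + 1)                           ≡⟨ sumFin-const k (+ 1) ⟩
    + k * + 1                                      ≡⟨ ℤ.*-identityʳ (+ k) ⟩
    + k                                            ∎
    where open ≡-Reasoning

  dist-self : ∀ a → dist a a ≡ 0
  dist-self a = cong₂ ℕ._+_ (ℕ.n∸n≡0 a) (ℕ.n∸n≡0 a)

  dist-sym : ∀ a b → dist a b ≡ dist b a
  dist-sym a b = ℕ.+-comm (a ℕ.∸ b) (b ℕ.∸ a)

  dist≡1⇒≢ : ∀ {k} {x x' : Fin k} → dist (toℕ x) (toℕ x') ≡ 1 → x' ≢ x
  dist≡1⇒≢ {x = x} d refl = ℕ.0≢1+n (trans (sym (dist-self (toℕ x))) d)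

  neighbourIndex : ∀ {k} → Fin (suc (suc k)) → Fin (suc (suc k))
  neighbourIndex zero    = suc zero
  neighbourIndex (suc x) = inject₁ x

  dist-neighbourIndex : ∀ {k} (x : Fin (suc (suc k))) → dist (toℕ x) (toℕ (neighbourIndex x)) ≡ 1
  dist-neighbourIndex zero    = refl
  dist-neighbourIndex (suc x) rewrite Fin.toℕ-inject₁ x | ℕ.m≤n⇒m∸n≡0 (ℕ.n≤1+n (toℕ x)) =
    trans (ℕ.+-identityʳ _) (ℕ.m+n∸n≡m 1 (toℕ x))

  adjacent-change : ∀ k (s : Fin k → Bool) y y' → s y ≢ s y' →
                    ∃ λ z → ∃ λ z' → dist (toℕ z) (toℕ z') ≡ 1 × s z ≢ s z'
  adjacent-change (suc k)       s zero    zero     ne = ⊥-elim (ne refl)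
  adjacent-change (suc k)       s (suc y) (suc y') ne with adjacent-change k (s ∘ suc) y y' ne
  ... | z , z' , d , nz = suc z , suc z' , d , nz
  adjacent-change (suc (suc k)) s zero    (suc y') ne with s zero ≟ᵇ s (suc zero)
  ... | no  ne₀₁ = zero , suc zero , refl , ne₀₁
  ... | yes e₀₁ with adjacent-change (suc k) (s ∘ suc) zero y' (ne ∘ trans e₀₁)
  ...   | z , z' , d , nz = suc z , suc z' , d , nz
  adjacent-change (suc (suc k)) s (suc y) zero     ne with s zero ≟ᵇ s (suc zero)
  ... | no  ne₀₁ = zero , suc zero , refl , ne₀₁
  ... | yes e₀₁ with adjacent-change (suc k) (s ∘ suc) y zero (λ e → ne (trans e (sym e₀₁)))
  ...   | z , z' , d , nz = suc z , suc z' , d , nz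
  adjacent-change (suc zero)    s zero    (suc ()) _
  adjacent-change (suc zero)    s (suc ()) zero    _

  three-distinct⇒2<n : ∀ {n} (y₀ y₁ y₂ : Fin n) → y₀ ≢ y₁ → y₀ ≢ y₂ → y₁ ≢ y₂ → 2 ℕ.< n
  three-distinct⇒2<n {suc (suc (suc _))} _ _ _ _ _ _ = s≤s (s≤s (s≤s z≤n))
  three-distinct⇒2<n zero          zero          _             ≢ _ _ = ⊥-elim (≢ refl)
  three-distinct⇒2<n zero          (suc zero)    zero          _ ≢ _ = ⊥-elim (≢ refl)
  three-distinct⇒2<n zero          (suc zero)    (suc zero)    _ _ ≢ = ⊥-elim (≢ refl)
  three-distinct⇒2<n (suc zero)    zero          zero          _ _ ≢ = ⊥-elim (≢ refl)
  three-distinct⇒2<n (suc zero)    zero          (suc zero)    _ ≢ _ = ⊥-elim (≢ refl)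
  three-distinct⇒2<n (suc zero)    (suc zero)    _             ≢ _ _ = ⊥-elim (≢ refl)
  three-distinct⇒2<n {suc zero} zero (suc ()) _ _ _ _

  IsDiagonal : ∀ {m n} → Vtx m n → Vtx m n → Set
  IsDiagonal (x , y) (x' , y') = x' ≢ x × y' ≢ y × dist (toℕ x) (toℕ x') ≡ dist (toℕ y) (toℕ y')

  diagonal-step : ∀ {k n} (x : Fin (suc (suc k))) (y y' : Fin n) → dist (toℕ y) (toℕ y') ≡ 1 →
                  IsDiagonal (x , y) (neighbourIndex x , y')
  diagonal-step x y y' d =
    dist≡1⇒≢ (dist-neighbourIndex x) , dist≡1⇒≢ d , trans (dist-neighbourIndex x) (sym d)

  diagonal : ∀ {k l} → Vtx (suc (suc k)) (suc (suc l)) → Vtx (suc (suc k)) (suc (suc l))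
  diagonal (x , y) = neighbourIndex x , neighbourIndex y

  diagonal-isDiagonal : ∀ {k l} (w : Vtx (suc (suc k)) (suc (suc l))) → IsDiagonal w (diagonal w)
  diagonal-isDiagonal (x , y) = diagonal-step x y (neighbourIndex y) (dist-neighbourIndex y)

  module _ {m n : ℕ} (G : SimpleGraph m n) (queen : HasQueenSpanning G) where

    queen-edge : ∀ {w v} → v ≢ w → QueenAdj w v → + 1 ≤ b2z (adj G w v)
    queen-edge v≢w attack = ℤ.≤-reflexive (cong b2z (sym (queen _ _ (v≢w ∘ sym) attack)))

    column+row+point≤adj : ∀ {w d} → IsDiagonal w d → ∀ v → v ≢ w →
                           ⟦ proj₁ v Fin.≟ proj₁ w ⟧ + ⟦ proj₂ v Fin.≟ proj₂ w ⟧ + ⟦ v ≟V d ⟧ ≤ b2z (adj G w v)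
    column+row+point≤adj {xw , yw} {d} (xd≢xw , yd≢yw , same-dist) (x , y) v≢w
      with x Fin.≟ xw | y Fin.≟ yw | (x , y) ≟V d
    ... | yes refl | yes refl | _        = ⊥-elim (v≢w refl)
    ... | yes refl | no _     | yes refl = ⊥-elim (xd≢xw refl)
    ... | yes refl | no _     | no _     = queen-edge v≢w (inj₁ refl)
    ... | no _     | yes refl | yes refl = ⊥-elim (yd≢yw refl)
    ... | no _     | yes refl | no _     = queen-edge v≢w (inj₂ (inj₁ refl))
    ... | no _     | no _     | yes refl = queen-edge v≢w (inj₂ (inj₂ same-dist))
    ... | no _     | no _     | no _     = b2z-nonneg _

    sumV-column+row+point : ∀ w d (h : Vtx m n → ℤ) →
      sumV (λ v → (⟦ proj₁ v Fin.≟ proj₁ w ⟧ + ⟦ proj₂ v Fin.≟ proj₂ w ⟧ + ⟦ v ≟V d ⟧) * h v)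
        ≡ sumFin n (λ y → h (proj₁ w , y)) + sumFin m (λ x → h (x , proj₂ w)) + h d
    sumV-column+row+point (x₀ , y₀) d h = begin
      sumV (λ v → (column v + row v + point v) * h v)
        ≡⟨ sumV-cong (λ v → distrib (column v) (row v) (point v) (h v)) ⟩
      sumV (λ v → column v * h v + row v * h v + point v * h v)
        ≡⟨ trans (sumV-+ (λ v → column v * h v + row v * h v) (λ v → point v * h v))
                 (cong (_+ sumV (λ v → point v * h v)) (sumV-+ (λ v → column v * h v) (λ v → row v * h v))) ⟩
      sumV (λ v → column v * h v) + sumV (λ v → row v * h v) + sumV (λ v → point v * h v)
        ≡⟨ cong₂ _+_ (cong₂ _+_ column-sum row-sum) (sumV-δ h d) ⟩
      sumFin n (λ y → h (x₀ , y)) + sumFin m (λ x → h (x , y₀)) + h d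
        ∎
      where
      open ≡-Reasoning
      column row point : Vtx m n → ℤ
      column v = ⟦ proj₁ v Fin.≟ x₀ ⟧
      row    v = ⟦ proj₂ v Fin.≟ y₀ ⟧
      point  v = ⟦ v ≟V d ⟧
      distrib : ∀ a b c e → (a + b + c) * e ≡ a * e + b * e + c * e
      distrib = solve-∀
      column-sum : sumV (λ v → column v * h v) ≡ sumFin n (λ y → h (x₀ , y))
      column-sum = trans (sumFin-cong m (λ x → sumFin-*ˡ n (column (x , y₀)) (λ y → h (x , y))))
                         (sumFin-δ m x₀ _)
      row-sum : sumV (λ v → row v * h v) ≡ sumFin m (λ x → h (x , y₀))
      row-sum = sumFin-cong m (λ x → sumFin-δ n y₀ (λ y → h (x , y)))

    queen-neighbours : ∀ S w d → S w ≡ false → IsDiagonal w d →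
                       colCount S (proj₁ w) + rowCount S (proj₂ w) + b2z (S d) ≤ neighboursIn G S w
    queen-neighbours S w d off diag = ℤ.≤-trans (ℤ.≤-reflexive (sym (sumV-column+row+point w d (b2z ∘ S))))
                                                (sumV-mono term)
      where
      rays : Vtx m n → ℤ
      rays v = ⟦ proj₁ v Fin.≟ proj₁ w ⟧ + ⟦ proj₂ v Fin.≟ proj₂ w ⟧ + ⟦ v ≟V d ⟧
      term : ∀ v → rays v * b2z (S v) ≤ b2z (adj G w v ∧ S v)
      term v with S v in Sv
      ... | false = ℤ.≤-trans (ℤ.≤-reflexive (ℤ.*-zeroʳ (rays v))) (b2z-nonneg (adj G w v ∧ false))
      ... | true  = ℤ.≤-trans (ℤ.≤-reflexive (ℤ.*-identityʳ (rays v)))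
                     (ℤ.≤-trans (column+row+point≤adj diag v v≢w)
                                (ℤ.≤-reflexive (cong b2z (sym (∧-identityʳ (adj G w v))))))
        where
        v≢w : v ≢ w
        v≢w v≡w = true≢false (trans (sym Sv) (trans (cong S v≡w) off))



  -- Counting chips when a poorest row burns

  module PoorestRowBurnt {a b : ℕ} (G : SimpleGraph (suc (suc a)) (suc (suc b))) (queen : HasQueenSpanning G)
                         (D : Divisor (suc (suc a)) (suc (suc b))) (D-effective : Effective D)
                         (q : Vtx (suc (suc a)) (suc (suc b))) where

    m n : ℕ
    m = suc (suc a)
    n = suc (suc b)

    open Burning G D q

    unburnt : Vtx m n → Bool
    unburnt = not ∘ burnt

    target : ℤ
    target = + suc a * + n + + 2

    column-products row-products : ℤ
    column-products = sumFin m (λ x → colCount unburnt x * colCount burnt x)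
    row-products    = sumFin n (λ y → rowCount unburnt y * rowCount burnt y)

    distinct-rows : ∀ {x x' y y'} → burnt (x , y) ≡ true → burnt (x' , y') ≡ false → x ≡ x' → y ≢ y'
    distinct-rows on off refl refl = true≢false (trans (sym on) off)

    chips-of-unburnt : ∀ v K → (burnt v ≡ false → K ≤ neighboursIn G burnt v) → b2z (unburnt v) * K ≤ D v
    chips-of-unburnt v K bound with burnt v in Bv
    ... | true  = ℤ.≤-trans (ℤ.≤-reflexive (ℤ.*-zeroˡ K)) (D-effective v)
    ... | false = ℤ.≤-trans (ℤ.≤-reflexive (ℤ.*-identityˡ K)) (ℤ.≤-trans (bound refl) (unburnt-stable v Bv))

    total-bound : (ext : Vtx m n → ℤ) →
      (∀ v → burnt v ≡ false → colCount burnt (proj₁ v) + rowCount burnt (proj₂ v) + ext v ≤ neighboursIn G burnt v) →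
      column-products + row-products + sumV (λ v → b2z (unburnt v) * ext v) ≤ deg D
    total-bound ext bound = begin
      column-products + row-products + sumV (λ v → χ v * ext v)  ≡⟨ sym decomposition ⟩
      sumV (λ v → χ v * (col v + row v + ext v))                 ≤⟨ sumV-mono (λ v → chips-of-unburnt v _ (bound v)) ⟩
      deg D                                                      ∎
      where
      open ℤ.≤-Reasoning
      χ col row : Vtx m n → ℤ
      χ v   = b2z (unburnt v)
      col v = colCount burnt (proj₁ v)
      row v = rowCount burnt (proj₂ v)
      distrib : ∀ u c r e → u * (c + r + e) ≡ u * c + u * r + u * e
      distrib = solve-∀
      columns : sumV (λ v → χ v * col v) ≡ column-products
      columns = sumFin-cong m (λ x → sumFin-*ʳ n (colCount burnt x) (λ y → χ (x , y)))
      rows : sumV (λ v → χ v * row v) ≡ row-products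
      rows = trans (sumFin-swap m n (λ x y → χ (x , y) * rowCount burnt y))
                   (sumFin-cong n (λ y → sumFin-*ʳ m (rowCount burnt y) (λ x → χ (x , y))))
      decomposition : sumV (λ v → χ v * (col v + row v + ext v)) ≡
                      column-products + row-products + sumV (λ v → χ v * ext v)
      decomposition = begin-equality
        sumV (λ v → χ v * (col v + row v + ext v))
          ≡⟨ sumV-cong (λ v → distrib (χ v) (col v) (row v) (ext v)) ⟩
        sumV (λ v → χ v * col v + χ v * row v + χ v * ext v)
          ≡⟨ sumV-+ (λ v → χ v * col v + χ v * row v) (λ v → χ v * ext v) ⟩
        sumV (λ v → χ v * col v + χ v * row v) + sumV (λ v → χ v * ext v)
          ≡⟨ cong (_+ sumV (λ v → χ v * ext v)) (sumV-+ (λ v → χ v * col v) (λ v → χ v * row v)) ⟩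
        sumV (λ v → χ v * col v) + sumV (λ v → χ v * row v) + sumV (λ v → χ v * ext v)
          ≡⟨ cong (_+ sumV (λ v → χ v * ext v)) (cong₂ _+_ columns rows) ⟩
        column-products + row-products + sumV (λ v → χ v * ext v)
          ∎

    row-bound : ∀ y K → (∀ x → burnt (x , y) ≡ false → K ≤ neighboursIn G burnt (x , y)) →
                rowCount unburnt y * K ≤ rowChips D y
    row-bound y K bound = ℤ.≤-trans (ℤ.≤-reflexive (sym (sumFin-*ʳ m K (λ x → b2z (unburnt (x , y))))))
                                    (sumFin-mono m (λ x → chips-of-unburnt (x , y) K (bound x)))

    module _ (y₀ : Fin n) (row₀-burnt : ∀ x → burnt (x , y₀) ≡ true) where

      colBurnt-pos : ∀ x → + 1 ≤ colCount burnt x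
      colBurnt-pos x = count-pos n (λ y → burnt (x , y)) y₀ (row₀-burnt x)

      diagonal-bound : ∀ v → burnt v ≡ false →
                       colCount burnt (proj₁ v) + rowCount burnt (proj₂ v) + + 0 ≤ neighboursIn G burnt v
      diagonal-bound v off =
        ℤ.≤-trans (ℤ.+-monoʳ-≤ (colCount burnt (proj₁ v) + rowCount burnt (proj₂ v)) (b2z-nonneg (burnt (diagonal v))))
                  (queen-neighbours G queen burnt v (diagonal v) off (diagonal-isDiagonal v))

      unburnt-row-chips : ∀ y c → + 0 ≤ c →
        (∀ x → burnt (x , y) ≡ false → ∃ λ d → IsDiagonal (x , y) d × c ≤ b2z (burnt d)) →
        ∀ x → burnt (x , y) ≡ false → + m + c ≤ rowChips D y
      unburnt-row-chips y c 0≤c diagonal-burnt x₁ off₁ =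
        ℤ.≤-trans (parts-product-shifted c (count-complement m (λ x → burnt (x , y)))
                                           (count-pos m (λ x → unburnt (x , y)) x₁ (cong not off₁))
                                           (count-nonneg m (λ x → burnt (x , y))) 0≤c)
                  (row-bound y _ neighbours)
        where
        neighbours : ∀ x → burnt (x , y) ≡ false → + 1 + rowCount burnt y + c ≤ neighboursIn G burnt (x , y)
        neighbours x off with diagonal-burnt x off
        ... | d , diag , c≤ = ℤ.≤-trans (ℤ.+-mono-≤ (ℤ.+-monoˡ-≤ (rowCount burnt y) (colBurnt-pos x)) c≤)
                                        (queen-neighbours G queen burnt (x , y) d off diag)

      columns-bound : ∀ y₁ → (∀ x → burnt (x , y₁) ≡ false) → + m * + suc b ≤ column-products
      columns-bound y₁ row₁-unburnt = ℤ.≤-trans (ℤ.≤-reflexive (sym (sumFin-const m (+ suc b))))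
        (sumFin-mono m (λ x → parts-product (count-complement n (λ y → burnt (x , y)))
                                            (count-pos n (λ y → unburnt (x , y)) y₁ (cong not (row₁-unburnt x)))
                                            (colBurnt-pos x)))

      row-product-nonneg : ∀ y → + 0 ≤ rowCount unburnt y * rowCount burnt y
      row-product-nonneg y = *-nonneg (count-nonneg m (λ x → unburnt (x , y))) (count-nonneg m (λ x → burnt (x , y)))

      Mixed : Fin n → Set
      Mixed y = (∃ λ x → burnt (x , y) ≡ false) × (∃ λ x → burnt (x , y) ≡ true)

      mixed? : ∀ y → Dec (Mixed y)
      mixed? y = Fin.any? (λ x → burnt (x , y) ≟ᵇ false) ×-dec Fin.any? (λ x → burnt (x , y) ≟ᵇ true)

      mixed-row-bound : ∀ y₁ → (∀ x → burnt (x , y₁) ≡ false) → ∀ y₂ → Mixed y₂ → target ≤ deg D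
      mixed-row-bound y₁ row₁-unburnt y₂ ((x₁ , off₁) , (x₂ , on₂)) = begin
        target                                  ≤⟨ ≤-+-nonneg (ℤ.i≤j⇒0≤j-i 1≤b) ⟩
        target + (+ b - + 1)                    ≡⟨ rearrange (+ a) (+ b) ⟩
        + m * + suc b + (+ m - + 1) + + 0       ≤⟨ ℤ.+-mono-≤ (ℤ.+-mono-≤ (columns-bound y₁ row₁-unburnt) rows) no-extra ⟩
        column-products + row-products
          + sumV (λ v → b2z (unburnt v) * + 0)  ≤⟨ total-bound (λ _ → + 0) diagonal-bound ⟩
        deg D                                   ∎
        where
        open ℤ.≤-Reasoning
        rearrange : ∀ A B → (+ 1 + A) * (+ 2 + B) + + 2 + (B - + 1) ≡ (+ 2 + A) * (+ 1 + B) + (+ 1 + A) + + 0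
        rearrange = solve-∀
        1≤b : + 1 ≤ + b
        1≤b with three-distinct⇒2<n y₀ y₁ y₂ (distinct-rows (row₀-burnt x₁) (row₁-unburnt x₁) refl)
                                           (distinct-rows (row₀-burnt x₁) off₁ refl)
                                           (distinct-rows on₂ (row₁-unburnt x₂) refl ∘ sym)
        ... | s≤s (s≤s 1≤b) = +≤+ 1≤b
        rows : + m - + 1 ≤ row-products
        rows = ℤ.≤-trans (parts-product (count-complement m (λ x → burnt (x , y₂)))
                                        (count-pos m (λ x → unburnt (x , y₂)) x₁ (cong not off₁))
                                        (count-pos m (λ x → burnt (x , y₂)) x₂ on₂))
                         (term≤sumFin n row-product-nonneg y₂)
        no-extra : + 0 ≤ sumV (λ v → b2z (unburnt v) * + 0)
        no-extra = sumV-nonneg (λ v → ℤ.≤-reflexive (sym (ℤ.*-zeroʳ (b2z (unburnt v)))))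

      adjacent-pure-rows-bound : ∀ yB yU → (∀ x → burnt (x , yB) ≡ true) → (∀ x → burnt (x , yU) ≡ false) →
                                 dist (toℕ yU) (toℕ yB) ≡ 1 → target ≤ deg D
      adjacent-pure-rows-bound yB yU rowB-burnt rowU-unburnt adjacent = begin
        target                                ≤⟨ ≤-+-nonneg (+≤+ z≤n) ⟩
        target + + b                          ≡⟨ rearrange (+ a) (+ b) ⟩
        + m * + suc b + + 0 + + m             ≤⟨ ℤ.+-mono-≤ (ℤ.+-mono-≤ (columns-bound yU rowU-unburnt)
                                                                       (sumFin-nonneg n row-product-nonneg))
                                                            (ℤ.≤-reflexive (sym unburnt-row-sum)) ⟩
        column-products + row-products
          + sumV (λ v → b2z (unburnt v) * ⟦ proj₂ v Fin.≟ yU ⟧)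
                                              ≤⟨ total-bound (λ v → ⟦ proj₂ v Fin.≟ yU ⟧) bound ⟩
        deg D                                 ∎
        where
        open ℤ.≤-Reasoning
        rearrange : ∀ A B → (+ 1 + A) * (+ 2 + B) + + 2 + B ≡ (+ 2 + A) * (+ 1 + B) + + 0 + (+ 2 + A)
        rearrange = solve-∀
        bound : ∀ v → burnt v ≡ false →
                colCount burnt (proj₁ v) + rowCount burnt (proj₂ v) + ⟦ proj₂ v Fin.≟ yU ⟧ ≤ neighboursIn G burnt v
        bound (x , y) off with y Fin.≟ yU
        ... | no _     = diagonal-bound (x , y) off
        ... | yes refl =
          ℤ.≤-trans (ℤ.≤-reflexive (cong (λ t → colCount burnt x + rowCount burnt y + b2z t) (sym (rowB-burnt _))))
                    (queen-neighbours G queen burnt (x , y) (neighbourIndex x , yB) off (diagonal-step x y yB adjacent))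
        unburnt-row-sum : sumV (λ v → b2z (unburnt v) * ⟦ proj₂ v Fin.≟ yU ⟧) ≡ + m
        unburnt-row-sum = begin-equality
          sumV (λ v → b2z (unburnt v) * ⟦ proj₂ v Fin.≟ yU ⟧)
            ≡⟨ sumV-cong (λ v → ℤ.*-comm (b2z (unburnt v)) ⟦ proj₂ v Fin.≟ yU ⟧) ⟩
          sumV (λ v → ⟦ proj₂ v Fin.≟ yU ⟧ * b2z (unburnt v))
            ≡⟨ sumFin-cong m (λ x → sumFin-δ n yU (λ y → b2z (unburnt (x , y)))) ⟩
          sumFin m (λ x → b2z (unburnt (x , yU)))
            ≡⟨ sumFin-cong m (λ x → cong (b2z ∘ not) (rowU-unburnt x)) ⟩
          sumFin m (λ _ → + 1)
            ≡⟨ trans (sumFin-const m (+ 1)) (ℤ.*-identityʳ (+ m)) ⟩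
          + m
            ∎

      unmixed-burnt : ∀ {y x'} → ¬ Mixed y → burnt (x' , y) ≡ true → ∀ x → burnt (x , y) ≡ true
      unmixed-burnt unmixed on x = ¬-not (λ off → unmixed ((x , off) , (_ , on)))

      unmixed-unburnt : ∀ {y x'} → ¬ Mixed y → burnt (x' , y) ≡ false → ∀ x → burnt (x , y) ≡ false
      unmixed-unburnt unmixed off x = ¬-not (λ on → unmixed ((_ , off) , (x , on)))

      pure-rows-bound : ∀ y₁ → (∀ x → burnt (x , y₁) ≡ false) → (∀ y → ¬ Mixed y) → target ≤ deg D
      pure-rows-bound y₁ row₁-unburnt unmixed
        with adjacent-change n (λ y → burnt (zero , y)) y₀ y₁
                             (λ e → true≢false (trans (sym (row₀-burnt zero)) (trans e (row₁-unburnt zero))))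
      ... | z , z' , adjacent , differ with burnt (zero , z) in Bz | burnt (zero , z') in Bz'
      ...   | true  | true  = ⊥-elim (differ refl)
      ...   | false | false = ⊥-elim (differ refl)
      ...   | true  | false = adjacent-pure-rows-bound z z' (unmixed-burnt (unmixed z) Bz) (unmixed-unburnt (unmixed z') Bz')
                                                       (trans (dist-sym (toℕ z') (toℕ z)) adjacent)
      ...   | false | true  = adjacent-pure-rows-bound z' z (unmixed-burnt (unmixed z') Bz') (unmixed-unburnt (unmixed z) Bz)
                                                       adjacent

      unburnt-row-bound : ∀ y₁ → (∀ x → burnt (x , y₁) ≡ false) → target ≤ deg D
      unburnt-row-bound y₁ row₁-unburnt with Fin.any? mixed?
      ... | yes (y₂ , mixed) = mixed-row-bound y₁ row₁-unburnt y₂ mixed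
      ... | no  unmixed      = pure-rows-bound y₁ row₁-unburnt (λ y mixed → unmixed (y , mixed))

      module Equitable (u : Vtx m n) (u-unburnt : burnt u ≡ false)
                       (row-has-burnt : ∀ y → ∃ λ x → burnt (x , y) ≡ true)
                       (equitable : RowEquitable G D) (y₀-poorest : IsPoorestRow D y₀) where

        -- Firing the unburnt set gives the effective equivalent divisor that row-equitability is tested on.
        D₁ : Divisor m n
        D₁ = D -ᴰ laplacian G (b2z ∘ unburnt)

        D₁-at-burnt : ∀ w → burnt w ≡ true → D₁ w ≡ D w + neighboursIn G unburnt w
        D₁-at-burnt w on = trans (cong (_-_ (D w)) (laplacian-indicator-outside G unburnt w (cong not on)))
                                 (cong (_+_ (D w)) (ℤ.neg-involutive (neighboursIn G unburnt w)))

        D₁-at-unburnt : ∀ w → burnt w ≡ false → D₁ w ≡ D w - neighboursIn G burnt w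
        D₁-at-unburnt w off =
          cong (_-_ (D w)) (trans (laplacian-indicator-inside G unburnt w (cong not off))
                                  (neighboursIn-cong G (not-involutive ∘ burnt) w))

        D₁-effective : Effective D₁
        D₁-effective w = by-cases (burnt w) refl
          where
          by-cases : ∀ b → burnt w ≡ b → + 0 ≤ D₁ w
          by-cases true  on  = ℤ.≤-trans (ℤ.+-mono-≤ (D-effective w) (neighboursIn-nonneg G unburnt w))
                                         (ℤ.≤-reflexive (sym (D₁-at-burnt w on)))
          by-cases false off = ℤ.≤-trans (ℤ.i≤j⇒0≤j-i (unburnt-stable w off))
                                         (ℤ.≤-reflexive (sym (D₁-at-unburnt w off)))

        D~D₁ : D ~[ G ] D₁
        D~D₁ = fireable-set G q unburnt D D₁ (λ _ → refl)

        ys : Fin n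
        ys = proj₁ (poorest-row-exists D₁)

        ys-not-richer : rowChips D₁ ys ≤ rowChips D y₀
        ys-not-richer = proj₂ equitable D₁ D₁-effective D~D₁ y₀ ys y₀-poorest (proj₂ (poorest-row-exists D₁))

        unburnt-lines≤neighbours : ∀ w → burnt w ≡ true →
                                   colCount unburnt (proj₁ w) + rowCount unburnt (proj₂ w) ≤ neighboursIn G unburnt w
        unburnt-lines≤neighbours w on =
          ℤ.≤-trans (≤-+-nonneg (b2z-nonneg (unburnt (diagonal w))))
                    (queen-neighbours G queen unburnt w (diagonal w) (cong not on) (diagonal-isDiagonal w))

        ys-has-unburnt : ∃ λ x → burnt (x , ys) ≡ false
        ys-has-unburnt with Fin.any? (λ x → burnt (x , ys) ≟ᵇ false)
        ... | yes found = found
        ... | no  none  = ⊥-elim (ℤ.<-irrefl refl (begin-strict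
          rowChips D y₀   ≤⟨ y₀-poorest ys ⟩
          rowChips D ys   <⟨ sumFin-mono-< m {λ x → D (x , ys)} {λ x → D₁ (x , ys)} gains (proj₁ u) strict-gain ⟩
          rowChips D₁ ys  ≤⟨ ys-not-richer ⟩
          rowChips D y₀   ∎))
          where
          open ℤ.≤-Reasoning
          on : ∀ x → burnt (x , ys) ≡ true
          on x = ¬-not (λ off → none (x , off))
          gains : ∀ x → D (x , ys) ≤ D₁ (x , ys)
          gains x = ℤ.≤-trans (≤-+-nonneg (neighboursIn-nonneg G unburnt (x , ys)))
                              (ℤ.≤-reflexive (sym (D₁-at-burnt (x , ys) (on x))))
          column-of-u : + 1 ≤ neighboursIn G unburnt (proj₁ u , ys)
          column-of-u = ℤ.≤-trans (count-pos n (λ y → unburnt (proj₁ u , y)) (proj₂ u) (cong not u-unburnt))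
                                  (ℤ.≤-trans (≤-+-nonneg (count-nonneg m (λ x → unburnt (x , ys))))
                                             (unburnt-lines≤neighbours (proj₁ u , ys) (on (proj₁ u))))
          strict-gain : D (proj₁ u , ys) < D₁ (proj₁ u , ys)
          strict-gain = begin-strict
            D (proj₁ u , ys)                                          ≡⟨ sym (ℤ.+-identityʳ (D (proj₁ u , ys))) ⟩
            D (proj₁ u , ys) + + 0                                    <⟨ ℤ.+-monoʳ-< (D (proj₁ u , ys))
                                                                            (ℤ.suc[i]≤j⇒i<j column-of-u) ⟩
            D (proj₁ u , ys) + neighboursIn G unburnt (proj₁ u , ys)  ≡⟨ sym (D₁-at-burnt (proj₁ u , ys) (on (proj₁ u))) ⟩
            D₁ (proj₁ u , ys)                                         ∎

        poorest-row-chips : + suc a ≤ rowChips D y₀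
        poorest-row-chips = begin
          + m - + 1                                           ≤⟨ parts-product row-partition burnt-in-ys unburnt-in-ys ⟩
          rowCount burnt ys * rowCount unburnt ys             ≡⟨ sym (sumFin-*ʳ m (rowCount unburnt ys) (b2z ∘ burnt ∘ (_, ys))) ⟩
          sumFin m (λ x → b2z (burnt (x , ys)) * rowCount unburnt ys)  ≤⟨ sumFin-mono m burnt-gain ⟩
          rowChips D₁ ys                                      ≤⟨ ys-not-richer ⟩
          rowChips D y₀                                       ∎
          where
          open ℤ.≤-Reasoning
          row-partition : rowCount burnt ys + rowCount unburnt ys ≡ + m
          row-partition = trans (ℤ.+-comm (rowCount burnt ys) (rowCount unburnt ys)) (count-complement m (λ x → burnt (x , ys)))
          burnt-in-ys : + 1 ≤ rowCount burnt ys
          burnt-in-ys = count-pos m (λ x → burnt (x , ys)) (proj₁ (row-has-burnt ys)) (proj₂ (row-has-burnt ys))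
          unburnt-in-ys : + 1 ≤ rowCount unburnt ys
          unburnt-in-ys = count-pos m (λ x → unburnt (x , ys)) (proj₁ ys-has-unburnt) (cong not (proj₂ ys-has-unburnt))
          burnt-gain : ∀ x → b2z (burnt (x , ys)) * rowCount unburnt ys ≤ D₁ (x , ys)
          burnt-gain x = by-cases (burnt (x , ys)) refl
            where
            by-cases : ∀ c → burnt (x , ys) ≡ c → b2z (burnt (x , ys)) * rowCount unburnt ys ≤ D₁ (x , ys)
            by-cases true on = begin
              b2z (burnt (x , ys)) * rowCount unburnt ys   ≡⟨ cong (λ t → b2z t * rowCount unburnt ys) on ⟩
              + 1 * rowCount unburnt ys                    ≡⟨ ℤ.*-identityˡ (rowCount unburnt ys) ⟩
              rowCount unburnt ys                          ≤⟨ ≤-nonneg-+ (count-nonneg n (λ y → unburnt (x , y))) ⟩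
              colCount unburnt x + rowCount unburnt ys     ≤⟨ unburnt-lines≤neighbours (x , ys) on ⟩
              neighboursIn G unburnt (x , ys)              ≤⟨ ≤-nonneg-+ (D-effective (x , ys)) ⟩
              D (x , ys) + neighboursIn G unburnt (x , ys) ≡⟨ sym (D₁-at-burnt (x , ys) on) ⟩
              D₁ (x , ys)                                  ∎
            by-cases false off = begin
              b2z (burnt (x , ys)) * rowCount unburnt ys   ≡⟨ cong (λ t → b2z t * rowCount unburnt ys) off ⟩
              + 0 * rowCount unburnt ys                    ≡⟨ ℤ.*-zeroˡ (rowCount unburnt ys) ⟩
              + 0                                          ≤⟨ D₁-effective (x , ys) ⟩
              D₁ (x , ys)                                  ∎

        excess : Fin n → ℤ
        excess y = rowChips D y - + suc a

        excess-nonneg : ∀ y → + 0 ≤ excess y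
        excess-nonneg y = ℤ.i≤j⇒0≤j-i (ℤ.≤-trans poorest-row-chips (y₀-poorest y))

        excess-of-unburnt-row : ∀ y x → burnt (x , y) ≡ false → + 1 ≤ excess y
        excess-of-unburnt-row y x off = ≤-excess (ℤ.≤-trans (ℤ.≤-reflexive (sym (ℤ.+-identityʳ (+ m))))
          (unburnt-row-chips y (+ 0) ℤ.≤-refl (λ x _ → diagonal (x , y) , diagonal-isDiagonal (x , y) , b2z-nonneg _) x off))

        excess-of-lonely-row : (∀ y → y ≢ ys → ∀ x → burnt (x , y) ≡ true) → + 2 ≤ excess ys
        excess-of-lonely-row others = ≤-excess (ℤ.≤-trans (ℤ.≤-reflexive (ℤ.+-comm (+ 1) (+ m)))
          (unburnt-row-chips ys (+ 1) (+≤+ z≤n) diagonal-burnt (proj₁ ys-has-unburnt) (proj₂ ys-has-unburnt)))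
          where
          diagonal-burnt : ∀ x → burnt (x , ys) ≡ false → ∃ λ d → IsDiagonal (x , ys) d × + 1 ≤ b2z (burnt d)
          diagonal-burnt x _ = diagonal (x , ys) , diagonal-isDiagonal (x , ys) ,
            ℤ.≤-reflexive (cong b2z (sym (others _ (dist≡1⇒≢ (dist-neighbourIndex ys)) _)))

        total-excess : + 2 ≤ sumFin n excess
        total-excess with Fin.any? (λ y → ¬? (y Fin.≟ ys) ×-dec Fin.any? (λ x → burnt (x , y) ≟ᵇ false))
        ... | yes (y₂ , y₂≢ys , x₂ , off₂) =
          ℤ.≤-trans (ℤ.+-mono-≤ (excess-of-unburnt-row ys _ (proj₂ ys-has-unburnt))
                                (excess-of-unburnt-row y₂ x₂ off₂))
                    (two-terms≤sumFin n excess-nonneg ys y₂ (y₂≢ys ∘ sym))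
        ... | no  none = ℤ.≤-trans (excess-of-lonely-row (λ y y≢ys x → ¬-not (λ off → none (y , y≢ys , x , off))))
                                   (term≤sumFin n excess-nonneg ys)

        bound : target ≤ deg D
        bound = begin
          target                  ≡⟨ cong (_+ + 2) (ℤ.*-comm (+ suc a) (+ n)) ⟩
          + n * + suc a + + 2     ≤⟨ excess-sum n (rowChips D) (+ suc a) (+ 2) total-excess ⟩
          sumFin n (rowChips D)   ≡⟨ sym (sumFin-swap m n (λ x y → D (x , y))) ⟩
          deg D                   ∎
          where open ℤ.≤-Reasoning

    poorest-row-burnt⇒bound : ∀ {r} → IsRank G D r → + 0 < r → D q ≡ + 0 → RowEquitable G D →
                              ∀ y₀ → IsPoorestRow D y₀ → (∀ x → Burns G D q (x , y₀)) → target ≤ deg D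
    poorest-row-burnt⇒bound rank 0<r Dq≡0 equitable y₀ poorest burns =
      by-cases (Fin.any? (λ y → Fin.all? (λ x → burnt (x , y) ≟ᵇ false)))
      where
      row₀-burnt : ∀ x → burnt (x , y₀) ≡ true
      row₀-burnt x = burns⇒burnt (x , y₀) (burns x)
      by-cases : Dec (∃ λ y → ∀ x → burnt (x , y) ≡ false) → target ≤ deg D
      by-cases (yes (y₁ , row₁-unburnt)) = unburnt-row-bound y₀ row₀-burnt y₁ row₁-unburnt
      by-cases (no no-unburnt-row) =
        Equitable.bound y₀ row₀-burnt (proj₁ unburnt-vertex) (proj₂ unburnt-vertex) row-has-burnt equitable poorest
        where
        unburnt-vertex : ∃ λ v → burnt v ≡ false
        unburnt-vertex = positive-rank⇒unburnt rank 0<r Dq≡0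
        row-has-burnt : ∀ y → ∃ λ x → burnt (x , y) ≡ true
        row-has-burnt y with Fin.¬∀⟶∃¬ m (λ x → burnt (x , y) ≡ false) (λ x → burnt (x , y) ≟ᵇ false)
                                         (λ all-off → no-unburnt-row (y , all-off))
        ... | x , not-off = x , ¬-not not-off


open import Defs
open import Data.Nat using (ℕ; _≥_; _*_; _∸_)
import Data.Nat as ℕ
open import Data.Fin using (Fin)
open import Data.Integer using (ℤ; +_; _+_; _-_; _≤_; _<_)
open import Data.Product using (Σ; _×_; _,_; proj₁)
open import Relation.Binary.PropositionalEquality using (_≡_)

open import Data.Nat using (zero; suc; s≤s)
open import Data.Integer.Properties using (pos-*)
open import Relation.Binary.PropositionalEquality using (cong; subst; sym)
open QueenChipFiring using (module PoorestRowBurnt)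

lemma3p2 : (m n : ℕ) → m ≥ 2 → n ≥ 2 →
    (G : SimpleGraph m n) → HasQueenSpanning G →
    (D : Divisor m n) → RowEquitable G D →
    (r : ℤ) → IsRank G D r → + 0 < r →
    deg D ≤ + (m * n) - + 1 →
    (q : Vtx m n) → D q ≡ + 0 →
    (Σ (Fin n) λ y → IsPoorestRow D y × (∀ x → Burns G D q (x , y))) →
    + ((m ∸ 1) * n ℕ.+ 2) ≤ deg D
lemma3p2 (suc (suc a)) (suc (suc b)) _ _ G queen D equitable r rank 0<r _ q Dq≡0 (y₀ , poorest , burns) =
  subst (_≤ deg D) (cong (_+ + 2) (sym (pos-* (suc a) (suc (suc b)))))
        (PoorestRowBurnt.poorest-row-burnt⇒bound G queen D (proj₁ equitable) q rank 0<r Dq≡0 equitable y₀ poorest burns)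
lemma3p2 zero                _             ()        _         _ _ _ _ _ _ _ _ _ _ _
lemma3p2 (suc zero)          _             (s≤s ())  _         _ _ _ _ _ _ _ _ _ _ _
lemma3p2 (suc (suc _))       zero          _         ()        _ _ _ _ _ _ _ _ _ _ _
lemma3p2 (suc (suc _))       (suc zero)    _         (s≤s ())  _ _ _ _ _ _ _ _ _ _ _
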